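{- There is a set $A \subseteq \mathbb{N}$ with asymptotic density $d(A) = 0$ such that $R(A) = \{a/a' : a,a'\in A\}$ is dense in $\mathbb{Q}_p$ for every prime $p$.
   Context: $\mathbb{N} = \{1,2,\ldots\}$. The asymptotic density is $d(A)=\lim_{n\to\infty}|A\cap[1,n]|/n$ (when it exists). $\mathbb{Q}_p$ denotes the field of $p$-adic numbers with the $p$-adic metric. -}

module Defs where

open import Data.Bool using (Bool; true; false)
open import Data.Nat using (ℕ; zero; suc; _+_; _*_; _^_; _≤_)
open import Data.Nat.Divisibility using (_∣_)
open import Data.Integer using (ℤ; +_; ∣_∣)
open import Data.Rational using (ℚ; ↥_; _-_; _/_)
open import Data.Product using (Σ; ∃; _×_)
open import Relation.Binary.PropositionalEquality using (_≡_)

Subset : Set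
Subset = ℕ → Bool

count : Subset → ℕ → ℕ
count A zero = zero
count A (suc n) with A (suc n)
... | true  = suc (count A n)
... | false = count A n

-- d(A) = 0, i.e. lim_{n→∞} |A ∩ [1,n]| / n = 0:
-- for every k ≥ 1 there is N with |A ∩ [1,n]| / n ≤ 1/k for all n ≥ N.
DensityZero : Subset → Set
DensityZero A = ∀ (k : ℕ) → ∃ λ N → ∀ n → N ≤ n → suc k * count A n ≤ n

-- p-adic closeness on ℚ: |q - r|_p ≤ p^(-k), i.e. v_p(q - r) ≥ k.
-- (q - r is in lowest terms, so this is p^k dividing its numerator.)
pClose : ℕ → ℕ → ℚ → ℚ → Set
pClose p k q r = p ^ k ∣ ∣ ↥ (q - r) ∣

-- ℚ_p as the completion of ℚ: p-adic Cauchy sequences of rationals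
-- (with the Cauchy property stated with explicit witnesses).
record Qp (p : ℕ) : Set where
  field
    seq    : ℕ → ℚ
    cauchy : ∀ (k : ℕ) → ∃ λ N → ∀ m n → N ≤ m → N ≤ n → pClose p k (seq m) (seq n)
open Qp public

CloseQp : (p : ℕ) → ℕ → ℚ → Qp p → Set
CloseQp p k q x = ∃ λ N → ∀ n → N ≤ n → pClose p k q (seq x n)

-- R(A) = {a/a' : a, a' ∈ A} is dense in ℚ_p: every x ∈ ℚ_p and every
-- radius p^(-k) contain an element a/a' of R(A).
-- (a' is written suc b, so a' ≥ 1; a ∈ A with A ⊆ ℕ = {1,2,...}.)
RatioDenseQp : Subset → ℕ → Set
RatioDenseQp A p =
  ∀ (x : Qp p) (k : ℕ) → Σ ℕ λ a → Σ ℕ λ b →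
    A a ≡ true × A (suc b) ≡ true × CloseQp p k ((+ a) / suc b) x

module Submission where

-- A = ⋃_{N ≥ 1} {j·N! : 1 ≤ j ≤ N} has density zero and its ratio set is
-- dense in every ℚ_p.
--
-- Density: past K·K! every element of A is a multiple of K (it is j·N! with
-- N ≥ K), so |A ∩ [1,n]| ≤ K·K! + n/K; letting K grow gives d(A) = 0.  This
-- is proved for an arbitrary set with this "eventually multiples" property.
--
-- Ratio set: a rational q = n/D (lowest terms) and P = p^k are given.  Adding
-- a multiple z of P gives q + z = s/D with s ≥ 1, and for T = s + D this
-- equals (s·T!)/(D·T!), a quotient of two elements of A.  Rationals whose
-- numerator is divisible by P are closed under addition, so |q + z - y|_p is
-- small whenever |q - y|_p is.  Applying this to the centre q = x_N of a
-- Cauchy sequence representing x ∈ ℚ_p gives the theorem.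

open import Defs
open import Data.Bool using (Bool; true; false)
open import Data.Nat using (ℕ)
open import Data.Nat.Primality using (Prime)
open import Data.Product using (Σ; _×_)
open import Relation.Binary.PropositionalEquality using (_≡_)

open import Data.Nat as ℕ using (zero; suc; _≤_; _<_; _!; z≤n; s≤s; NonZero)
import Data.Nat.Properties as ℕP
open import Data.Nat.Primality using (prime⇒nonZero)
open import Data.Nat.Divisibility using (_∣_; _∣?_; divides; ∣-refl; ∣-trans; m∣m*n; n∣m*n; ∣⇒≤)
open import Data.Nat.Combinatorics using (k![n∸k]!∣n!)
import Data.Nat.Coprimality as Coprime
open import Data.Integer as ℤ using (ℤ; +_; -[1+_]; ∣_∣)
import Data.Integer.Properties as ℤP
import Data.Integer.Divisibility.Signed as ℤ∣
open import Data.Integer.Tactic.RingSolver using (solve-∀)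
open import Data.Rational as ℚ using (ℚ; mkℚ; ↥_; ↧_; ↧ₙ_; _/_; toℚᵘ; fromℚᵘ)
import Data.Rational.Properties as ℚP
import Data.Rational.Unnormalised as ℚᵘ
import Data.Rational.Unnormalised.Properties as ℚᵘP
open import Algebra.Bundles using (CommutativeMonoid)
import Algebra.Properties.CommutativeSemigroup as CommSemigroupProperties
open import Data.Product using (_,_; ∃; proj₁; proj₂)
open import Relation.Nullary using (does; yes; no; contradiction)
open import Relation.Nullary.Decidable using (dec-true; _×-dec_)
open import Relation.Unary using (Decidable)
open import Relation.Binary.PropositionalEquality using (refl; sym; trans; cong; subst; subst₂; module ≡-Reasoning)

fromℤ : ℤ → ℚ
fromℤ z = mkℚ z 0 (Coprime.sym (Coprime.1-coprimeTo ∣ z ∣))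

-- P divides the numerator of q in lowest terms, i.e. |q|_p ≤ p^(-k) when P = p^k.
NumDiv : ℕ → ℚ → Set
NumDiv P q = P ∣ ∣ ↥ q ∣

numDiv⇒coprime : ∀ {P} q → NumDiv P q → Coprime.Coprime P (↧ₙ q)
numDiv⇒coprime (mkℚ n d c) P∣n (i∣P , i∣d) = Coprime.recompute c (∣-trans i∣P P∣n , i∣d)

+-cross : ∀ p q → ↥ (p ℚ.+ q) ℤ.* (↧ p ℤ.* ↧ q) ≡ (↥ p ℤ.* ↧ q ℤ.+ ↥ q ℤ.* ↧ p) ℤ.* ↧ (p ℚ.+ q)
+-cross p@record{} q@record{} =
  subst₂ (λ a b → a ℤ.* (↧ p ℤ.* ↧ q) ≡ (↥ p ℤ.* ↧ q ℤ.+ ↥ q ℤ.* ↧ p) ℤ.* b)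
    (ℚP.↥ᵘ-toℚᵘ (p ℚ.+ q)) (ℚP.↧ᵘ-toℚᵘ (p ℚ.+ q)) (ℚᵘP.drop-*≡* (ℚP.toℚᵘ-homo-+ p q))

-- Rationals whose numerator is divisible by P are closed under addition
-- (the ultrametric inequality): by +-cross, P divides ↥(p+q)·↧p·↧q, and P is
-- coprime to ↧p and ↧q.
numDiv-+ : ∀ {P} p q → NumDiv P p → NumDiv P q → NumDiv P (p ℚ.+ q)
numDiv-+ {P} p q P∣p P∣q =
  Coprime.coprime-divisor (numDiv⇒coprime q P∣q)
    (Coprime.coprime-divisor (numDiv⇒coprime p P∣p) P∣den*num)
  where
  P∣cross : + P ℤ∣.∣ ↥ (p ℚ.+ q) ℤ.* (↧ p ℤ.* ↧ q)
  P∣cross = subst (+ P ℤ∣.∣_) (sym (+-cross p q)) (ℤ∣.∣m⇒∣m*n (↧ (p ℚ.+ q))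
    (ℤ∣.∣m∣n⇒∣m+n (ℤ∣.∣m⇒∣m*n (↧ q) (ℤ∣.∣ᵤ⇒∣ {i = ↥ p} P∣p))
                  (ℤ∣.∣m⇒∣m*n (↧ p) (ℤ∣.∣ᵤ⇒∣ {i = ↥ q} P∣q))))
  abs-cross : ∣ ↥ (p ℚ.+ q) ℤ.* (↧ p ℤ.* ↧ q) ∣ ≡ ↧ₙ p ℕ.* (↧ₙ q ℕ.* ∣ ↥ (p ℚ.+ q) ∣)
  abs-cross = begin
    ∣ ↥ (p ℚ.+ q) ℤ.* (↧ p ℤ.* ↧ q) ∣        ≡⟨ ℤP.abs-* (↥ (p ℚ.+ q)) (↧ p ℤ.* ↧ q) ⟩
    ∣ ↥ (p ℚ.+ q) ∣ ℕ.* (↧ₙ p ℕ.* ↧ₙ q)      ≡⟨ ℕP.*-comm ∣ ↥ (p ℚ.+ q) ∣ _ ⟩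
    (↧ₙ p ℕ.* ↧ₙ q) ℕ.* ∣ ↥ (p ℚ.+ q) ∣      ≡⟨ ℕP.*-assoc (↧ₙ p) (↧ₙ q) _ ⟩
    ↧ₙ p ℕ.* (↧ₙ q ℕ.* ∣ ↥ (p ℚ.+ q) ∣)      ∎
    where open ≡-Reasoning
  P∣den*num : P ∣ ↧ₙ p ℕ.* (↧ₙ q ℕ.* ∣ ↥ (p ℚ.+ q) ∣)
  P∣den*num = subst (P ∣_) abs-cross (ℤ∣.∣⇒∣ᵤ P∣cross)

numDiv-shift : ∀ {P} q y z → NumDiv P (q ℚ.- y) → P ∣ ∣ z ∣ → NumDiv P ((q ℚ.+ fromℤ z) ℚ.- y)
numDiv-shift {P} q y z P∣q-y P∣z =
  subst (NumDiv P) (sym (xy∙z≈xz∙y q (fromℤ z) (ℚ.- y))) (numDiv-+ (q ℚ.- y) (fromℤ z) P∣q-y P∣z)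
  where open CommSemigroupProperties (CommutativeMonoid.commutativeSemigroup ℚP.+-0-commutativeMonoid)

+fromℤ-as-fraction : ∀ q z s t → + s ≡ ↥ q ℤ.+ z ℤ.* ↧ q →
                     q ℚ.+ fromℤ z ≡ (+ (s ℕ.* suc t)) / (↧ₙ q ℕ.* suc t)
+fromℤ-as-fraction q@record{} z s t s≡n+zD = begin
  q ℚ.+ fromℤ z                        ≡⟨ sym (ℚP.fromℚᵘ-toℚᵘ (q ℚ.+ fromℤ z)) ⟩
  fromℚᵘ (toℚᵘ (q ℚ.+ fromℤ z))        ≡⟨ ℚP.fromℚᵘ-cong {y = fraction} (ℚᵘP.≃-trans (ℚP.toℚᵘ-homo-+ q (fromℤ z)) (ℚᵘ.*≡* cross)) ⟩
  fromℚᵘ fraction                      ≡⟨⟩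
  (+ (s ℕ.* suc t)) / (↧ₙ q ℕ.* suc t) ∎
  where
  open ≡-Reasoning
  fraction : ℚᵘ.ℚᵘ
  fraction = ℚᵘ.mkℚᵘ (+ (s ℕ.* suc t)) (ℕ.pred (↧ₙ q ℕ.* suc t))
  n = ↥ q
  D = ↧ q
  T = + suc t
  cross : (n ℤ.* ℤ.1ℤ ℤ.+ z ℤ.* D) ℤ.* (+ (↧ₙ q ℕ.* suc t)) ≡ (+ (s ℕ.* suc t)) ℤ.* (D ℤ.* ℤ.1ℤ)
  cross = begin
    (n ℤ.* ℤ.1ℤ ℤ.+ z ℤ.* D) ℤ.* (+ (↧ₙ q ℕ.* suc t)) ≡⟨ cong ((n ℤ.* ℤ.1ℤ ℤ.+ z ℤ.* D) ℤ.*_) (ℤP.pos-* (↧ₙ q) (suc t)) ⟩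
    (n ℤ.* ℤ.1ℤ ℤ.+ z ℤ.* D) ℤ.* (D ℤ.* T)          ≡⟨ rearrange n z D T ⟩
    ((n ℤ.+ z ℤ.* D) ℤ.* T) ℤ.* (D ℤ.* ℤ.1ℤ)       ≡⟨ cong (λ e → (e ℤ.* T) ℤ.* (D ℤ.* ℤ.1ℤ)) (sym s≡n+zD) ⟩
    ((+ s) ℤ.* T) ℤ.* (D ℤ.* ℤ.1ℤ)                 ≡⟨ cong (ℤ._* (D ℤ.* ℤ.1ℤ)) (sym (ℤP.pos-* s (suc t))) ⟩
    (+ (s ℕ.* suc t)) ℤ.* (D ℤ.* ℤ.1ℤ)             ∎
    where
    rearrange : ∀ (n z D T : ℤ) → (n ℤ.* ℤ.1ℤ ℤ.+ z ℤ.* D) ℤ.* (D ℤ.* T) ≡ ((n ℤ.+ z ℤ.* D) ℤ.* T) ℤ.* (D ℤ.* ℤ.1ℤ)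
    rearrange = solve-∀

positiveShift : ∀ P D .{{_ : NonZero P}} .{{_ : NonZero D}} (n : ℤ) →
                Σ ℕ λ s → Σ ℤ λ z → 1 ≤ s × P ∣ ∣ z ∣ × + s ≡ n ℤ.+ z ℤ.* + D
positiveShift P D (+ j) = j ℕ.+ P ℕ.* D , + P , 1≤s , ∣-refl , s≡n+zD
  where
  1≤s : 1 ≤ j ℕ.+ P ℕ.* D
  1≤s = ℕP.≤-trans (ℕP.≤-trans (ℕ.>-nonZero⁻¹ D) (ℕP.m≤n*m D P)) (ℕP.m≤n+m (P ℕ.* D) j)
  s≡n+zD : + (j ℕ.+ P ℕ.* D) ≡ + j ℤ.+ + P ℤ.* + D
  s≡n+zD = trans (ℤP.pos-+ j (P ℕ.* D)) (cong (ℤ._+_ (+ j)) (ℤP.pos-* P D))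
positiveShift P D -[1+ j ] = X ℕ.∸ suc j , + (P ℕ.* m) , ℕP.m<n⇒0<n∸m j<X , m∣m*n m , s≡n+zD
  where
  m = suc (suc j)
  X = P ℕ.* m ℕ.* D
  j<X : suc j < X
  j<X = ℕP.≤-trans (ℕP.m≤n*m m P) (ℕP.m≤m*n (P ℕ.* m) D)
  s≡n+zD : + (X ℕ.∸ suc j) ≡ -[1+ j ] ℤ.+ + (P ℕ.* m) ℤ.* + D
  s≡n+zD = trans (sym (ℤP.⊖-≥ (ℕP.<⇒≤ j<X))) (cong (ℤ._+_ -[1+ j ]) (ℤP.pos-* (P ℕ.* m) D))

EventuallyMultiplesOf : ℕ → Subset → ℕ → Set
EventuallyMultiplesOf K B M = ∀ m → M < m → B m ≡ true → K ∣ m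

count≤ : ∀ B n → count B n ≤ n
count≤ B zero = z≤n
count≤ B (suc n) with B (suc n)
... | true  = s≤s (count≤ B n)
... | false = ℕP.m≤n⇒m≤1+n (count≤ B n)

-- If B is eventually contained in Kℕ, then |B ∩ [1,n]| ≤ M + n/K: at most M
-- elements lie in [1,M] and every further element costs K units of n.
count-bound : ∀ K B M → EventuallyMultiplesOf K B M → ∀ n → K ℕ.* count B n ≤ K ℕ.* M ℕ.+ n
count-bound K B M mult zero = ℕP.≤-trans (ℕP.≤-reflexive (ℕP.*-zeroʳ K)) z≤n
count-bound K B M mult (suc n) with B (suc n) in n+1∈B
... | false = ℕP.≤-trans (count-bound K B M mult n) (ℕP.+-monoʳ-≤ (K ℕ.* M) (ℕP.n≤1+n n))
... | true with suc n ℕ.≤? M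
...   | yes n+1≤M = ℕP.≤-trans (ℕP.*-monoʳ-≤ K (ℕP.≤-trans (s≤s (count≤ B n)) n+1≤M))
                              (ℕP.m≤m+n (K ℕ.* M) (suc n))
...   | no n+1≰M with mult (suc n) (ℕP.≰⇒> n+1≰M) n+1∈B
...     | divides j n+1≡jK = subst (K ℕ.* suc c ≤_) (sym total≡) (ℕP.*-monoʳ-≤ K c<M+j)
  where
  c = count B n
  total≡ : K ℕ.* M ℕ.+ suc n ≡ K ℕ.* (M ℕ.+ j)
  total≡ = trans (cong (K ℕ.* M ℕ.+_) (trans n+1≡jK (ℕP.*-comm j K))) (sym (ℕP.*-distribˡ-+ K M j))
  c<M+j : c < M ℕ.+ j
  c<M+j = ℕP.*-cancelˡ-< K c (M ℕ.+ j)
            (subst (K ℕ.* c <_) (trans (sym (ℕP.+-suc (K ℕ.* M) n)) total≡) (s≤s (count-bound K B M mult n)))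

-- A set that is eventually contained in Kℕ for every K ≥ 1 has density zero:
-- with K = 2(k+1) and n ≥ K·M, the bound gives 2(k+1)·|B ∩ [1,n]| ≤ 2n.
densityZero : ∀ B → (∀ K → .{{NonZero K}} → ∃ (EventuallyMultiplesOf K B)) → DensityZero B
densityZero B eventually k = K ℕ.* M , λ n KM≤n → ℕP.*-cancelˡ-≤ 2 (bound n KM≤n)
  where
  K = 2 ℕ.* suc k
  M = proj₁ (eventually K)
  bound : ∀ n → K ℕ.* M ≤ n → 2 ℕ.* (suc k ℕ.* count B n) ≤ 2 ℕ.* n
  bound n KM≤n = begin
    2 ℕ.* (suc k ℕ.* count B n) ≡⟨ ℕP.*-assoc 2 (suc k) (count B n) ⟨
    K ℕ.* count B n             ≤⟨ count-bound K B M (proj₂ (eventually K)) n ⟩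
    K ℕ.* M ℕ.+ n               ≤⟨ ℕP.+-monoˡ-≤ n KM≤n ⟩
    n ℕ.+ n                     ≡⟨ cong (n ℕ.+_) (ℕP.+-identityʳ n) ⟨
    2 ℕ.* n                     ∎
    where open ℕP.≤-Reasoning

InBlock : ℕ → ℕ → Set
InBlock m N = N ! ∣ m × m ≤ N ℕ.* N !

inBlock? : ∀ m → Decidable (InBlock m)
inBlock? m N = (N ! ∣? m) ×-dec (m ℕ.≤? N ℕ.* N !)

-- A = ⋃_N {j·N! : 1 ≤ j ≤ N}.  Since N ≤ N! ≤ m for m in block N, searching
-- the indices N ≤ m decides membership.
A : Subset
A zero    = false
A (suc m) = does (ℕP.anyUpTo? (inBlock? (suc m)) (suc (suc m)))

A-sound : ∀ m → A m ≡ true → ∃ (InBlock m)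
A-sound (suc m) m∈A with ℕP.anyUpTo? (inBlock? (suc m)) (suc (suc m))
... | yes (N , _ , m∈block) = N , m∈block
A-sound (suc m) () | no _

A-intro : ∀ m N → 1 ≤ m → N ≤ m → InBlock m N → A m ≡ true
A-intro (suc m) N _ N≤m m∈block = dec-true (ℕP.anyUpTo? (inBlock? (suc m)) (suc (suc m))) (N , s≤s N≤m , m∈block)

!-mono-∣ : ∀ {m n} → m ≤ n → m ! ∣ n !
!-mono-∣ m≤n = ∣-trans (m∣m*n _) (k![n∸k]!∣n! m≤n)

n∣n! : ∀ n .{{_ : NonZero n}} → n ∣ n !
n∣n! (suc n) = m∣m*n (n !)

A-block : ∀ j T → 1 ≤ j → j ≤ T → A (j ℕ.* T !) ≡ true
A-block j T 1≤j j≤T = A-intro (j ℕ.* T !) T 1≤jT! T≤jT! (n∣m*n j , ℕP.*-monoˡ-≤ (T !) j≤T)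
  where
  instance
    T≢0 : NonZero T
    T≢0 = ℕ.>-nonZero (ℕP.≤-trans 1≤j j≤T)
    jT!≢0 : NonZero (j ℕ.* T !)
    jT!≢0 = ℕP.m*n≢0 j (T !) {{ℕ.>-nonZero 1≤j}} {{ℕP._!≢0 T}}
  1≤jT! : 1 ≤ j ℕ.* T !
  1≤jT! = ℕ.>-nonZero⁻¹ (j ℕ.* T !)
  T≤jT! : T ≤ j ℕ.* T !
  T≤jT! = ∣⇒≤ (∣-trans (n∣n! T) (n∣m*n j))

-- Beyond K·K! every element of A is a multiple of K: it lies in a block
-- N ≥ K (smaller blocks end below K·K!), and K ∣ K! ∣ N!.
A-eventuallyMultiples : ∀ K .{{_ : NonZero K}} → EventuallyMultiplesOf K A (K ℕ.* K !)
A-eventuallyMultiples K m KK!<m m∈A with A-sound m m∈A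
... | N , N!∣m , m≤NN! with K ℕ.≤? N
...   | yes K≤N = ∣-trans (n∣n! K) (∣-trans (!-mono-∣ K≤N) N!∣m)
...   | no K≰N  = contradiction m≤NN! (ℕP.<⇒≱ (ℕP.≤-<-trans NN!≤KK! KK!<m))
  where
  N≤K = ℕP.<⇒≤ (ℕP.≰⇒> K≰N)
  NN!≤KK! : N ℕ.* N ! ≤ K ℕ.* K !
  NN!≤KK! = ℕP.*-mono-≤ N≤K (∣⇒≤ {{ℕP._!≢0 K}} (!-mono-∣ N≤K))

A-densityZero : DensityZero A
A-densityZero = densityZero A λ K → K ℕ.* K ! , A-eventuallyMultiples K

-- For every rational q there are a, b+1 ∈ A such that a/(b+1) - y has
-- numerator divisible by P whenever q - y does: a/(b+1) = q + z with P ∣ z.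
ratio-approx : ∀ P .{{_ : NonZero P}} (q : ℚ) → Σ ℕ λ a → Σ ℕ λ b →
               A a ≡ true × A (suc b) ≡ true ×
               (∀ y → NumDiv P (q ℚ.- y) → NumDiv P ((+ a) / suc b ℚ.- y))
ratio-approx P q with positiveShift P (↧ₙ q) (↥ q)
... | s , z , 1≤s , P∣z , s≡n+zD =
  s ℕ.* suc t , ℕ.pred (↧ₙ q ℕ.* suc t) ,
  subst (λ u → A (s ℕ.* u) ≡ true) (sym t+1≡T!) (A-block s T 1≤s (ℕP.m≤m+n s (↧ₙ q))) ,
  subst (λ u → A (↧ₙ q ℕ.* u) ≡ true) (sym t+1≡T!) (A-block (↧ₙ q) T (s≤s z≤n) (ℕP.m≤n+m (↧ₙ q) s)) ,
  λ y q-y-small → subst (λ r → NumDiv P (r ℚ.- y)) (+fromℤ-as-fraction q z s t s≡n+zD)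
                        (numDiv-shift q y z q-y-small P∣z)
  where
  T = s ℕ.+ ↧ₙ q
  t = ℕ.pred (T !)
  t+1≡T! : suc t ≡ T !
  t+1≡T! = ℕP.suc-pred (T !) {{ℕP._!≢0 T}}

-- The theorem: A has density zero; for x ∈ ℚ_p and radius p^(-k), apply
-- ratio-approx with P = p^k to the term x_N after which the Cauchy sequence
-- of x stays within p^(-k) of x_N.
theorem3p5 : Σ Subset λ A → A 0 ≡ false × DensityZero A × (∀ (p : ℕ) → Prime p → RatioDenseQp A p)
theorem3p5 = A , refl , A-densityZero , ratioDense
  where
  ratioDense : ∀ p → Prime p → RatioDenseQp A p
  ratioDense p p-prime x k with cauchy x k
  ... | N , cauchy-k with ratio-approx (p ℕ.^ k) {{ℕP.m^n≢0 p k {{prime⇒nonZero p-prime}}}} (seq x N)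
  ...   | a , b , a∈A , b+1∈A , approx =
    a , b , a∈A , b+1∈A , N , λ n N≤n → approx (seq x n) (cauchy-k N n ℕP.≤-refl N≤n)
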